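{- For positive integers $k,l$, let $$\psi(k,l)=\max\{\Gamma(G[H]) : G,H \text{ finite simple graphs},\ \Gamma(G)=k,\ \Gamma(H)=l\}.$$ Let $\alpha$ be a positive integer. If $\psi(k,l)\ge kl+\alpha$, then $\psi(k',l)\ge k'l+\alpha$ for every integer $k'>k$.
   Context: The lexicographic product $G[H]$ has vertex set $V(G)\times V(H)$, and $(a,x)(b,y)$ is an edge iff $ab\in E(G)$, or $a=b$ and $xy\in E(H)$. A greedy $k$-colouring of a graph is a partition of its vertex set into $k$ nonempty stable sets $S_1,\dots,S_k$ such that for every $j<i$, every vertex of $S_i$ has a neighbour in $S_j$. The Grundy number $\Gamma$ is the largest such $k$. -}

module Defs where

open import Data.Nat using (ℕ; _*_; _<_; _≤_)
open import Data.Fin using (Fin; toℕ; remQuot)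
open import Data.Bool using (Bool; true; false; _∨_; _∧_)
open import Data.Product using (Σ; _×_; _,_; ∃; ∃-syntax)
open import Relation.Binary.PropositionalEquality using (_≡_; _≢_; refl) renaming (sym to sym≡)
open import Relation.Nullary using (¬_; yes; no)
open import Data.Empty using (⊥-elim)
open import Data.Fin using (_≟_)
open import Relation.Nullary.Decidable using (⌊_⌋)

record Graph : Set where
  field
    n    : ℕ
    adj  : Fin n → Fin n → Bool
    sym  : ∀ u v → adj u v ≡ adj v u
    irr  : ∀ v → adj v v ≡ false
open Graph public

Adj : (G : Graph) → Fin (n G) → Fin (n G) → Set
Adj G u v = adj G u v ≡ true

record GreedyColouring (G : Graph) (k : ℕ) : Set where
  field
    col      : Fin (n G) → Fin k
    nonempty : ∀ (i : Fin k) → ∃[ v ] col v ≡ i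
    stable   : ∀ u v → Adj G u v → col u ≢ col v
    greedy   : ∀ v (j : Fin k) → toℕ j < toℕ (col v) →
               ∃[ u ] (Adj G v u × col u ≡ j)

IsGrundy : Graph → ℕ → Set
IsGrundy G g = GreedyColouring G g × (∀ k → GreedyColouring G k → k ≤ g)

-- Lexicographic product G[H] on Fin (|G| * |H|); vertex i encodes the
-- pair remQuot |H| i = (a , x) ∈ V(G) × V(H).
pairAdj : (G H : Graph) → Fin (n G) × Fin (n H) → Fin (n G) × Fin (n H) → Bool
pairAdj G H (a , x) (b , y) = adj G a b ∨ (⌊ a ≟ b ⌋ ∧ adj H x y)

private
  dec-sym : ∀ {m} (a b : Fin m) → ⌊ a ≟ b ⌋ ≡ ⌊ b ≟ a ⌋
  dec-sym a b with a ≟ b | b ≟ a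
  ... | yes _ | yes _ = refl
  ... | no _ | no _ = refl
  ... | yes p | no q = ⊥-elim (q (sym≡ p))
  ... | no p | yes q = ⊥-elim (p (sym≡ q))

  ∧-false : ∀ b → b ∧ false ≡ false
  ∧-false true = refl
  ∧-false false = refl

  pairAdj-sym : ∀ G H p q → pairAdj G H p q ≡ pairAdj G H q p
  pairAdj-sym G H (a , x) (b , y)
    rewrite sym G a b | sym H x y | dec-sym a b = refl

  pairAdj-irr : ∀ G H p → pairAdj G H p p ≡ false
  pairAdj-irr G H (a , x) rewrite irr G a | irr H x = ∧-false ⌊ a ≟ a ⌋

lex : Graph → Graph → Graph
lex G H = record
  { n   = n G * n H
  ; adj = λ i j → pairAdj G H (remQuot (n H) i) (remQuot (n H) j)
  ; sym = λ i j → pairAdj-sym G H (remQuot (n H) i) (remQuot (n H) j)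
  ; irr = λ i → pairAdj-irr G H (remQuot (n H) i)
  }

-- Adding a universal vertex to G raises Γ(G) by exactly one, while in the
-- lexicographic product it contributes a new top layer: a copy of H adjacent
-- to everything else. Colouring that layer greedily with the l colours of H,
-- placed above the g colours of a Grundy colouring of G[H], gives a greedy
-- (g + l)-colouring, so Γ grows by at least l while k·l grows by exactly l.
-- Iterating this step reaches every k′ > k.
module Submission where

open import Data.Bool using (Bool; true; false; _∨_; _∧_)
import Data.Bool.Properties as Bool
open import Data.Empty using (⊥-elim)
open import Data.Fin using (Fin; zero; suc; toℕ; _↑ˡ_; _↑ʳ_; splitAt; combine; remQuot; punchIn; punchOut)
open import Data.Fin.Properties
  using ( _≟_; any?; all?; suc-injective; toℕ<n; toℕ-↑ˡ; toℕ-↑ʳ; ↑ˡ-injective; ↑ʳ-injective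
        ; splitAt⁻¹-↑ˡ; splitAt⁻¹-↑ʳ; remQuot-combine; combine-remQuot; injective⇒≤
        ; punchInᵢ≢i; punchIn-cancel-≤; punchIn-punchOut; punchOut-punchIn; punchOut-cong′
        ; punchOut-injective)
open import Data.Nat using (ℕ; zero; suc; _+_; _*_; _<_; _≤_; _≤′_; ≤′-refl; ≤′-step; z≤n; s≤s; s<s⁻¹)
open import Data.Nat.Properties
  using ( _<?_; ≤-trans; ≤-pred; ≤∧≢⇒<; n≤0⇒n≡0; <-≤-trans; <-irrefl; <-asym; ≰⇒>; <⇒≱
        ; m≤m+n; +-cancelˡ-<; +-monoʳ-≤; +-assoc; +-comm; ≤⇒≤′; module ≤-Reasoning)
open import Data.Product using (_×_; _,_; proj₁; proj₂; ∃; ∃-syntax; uncurry)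
open import Data.Sum using (inj₁; inj₂)
open import Data.Vec.Functional using (_∷_)
open import Data.Vec.Functional.Properties using (∷-cong)
open import Function using (_∘_; id)
open import Relation.Binary.PropositionalEquality
  using (_≡_; _≢_; _≗_; refl; sym; trans; cong; subst; subst₂)
open import Relation.Nullary using (Dec; yes; no; ¬?; contradiction)
open import Relation.Nullary.Decidable using (_×-dec_; _→-dec_; map′; ⌊⌋-map′)
open import Relation.Unary using (Decidable)
open import Defs hiding (sym)

∃-function? : ∀ m k (P : (Fin m → Fin k) → Set) →
  (∀ {f g} → f ≗ g → P f → P g) → (∀ f → Dec (P f)) → Dec (∃ P)
∃-function? zero k P resp P? with P? (λ ())
... | yes p = yes (_ , p)
... | no ¬p = no λ (f , pf) → ¬p (resp (λ ()) pf)
∃-function? (suc m) k P resp P?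
  with any? (λ a → ∃-function? m k (P ∘ (a ∷_)) (resp ∘ ∷-cong refl) (P? ∘ (a ∷_)))
... | yes (a , f , p) = yes (a ∷ f , p)
... | no ¬p = no λ (f , pf) → ¬p (f zero , f ∘ suc , resp (∷-cong refl λ _ → refl) pf)

maximum-exists : ∀ {p} {P : ℕ → Set p} → Decidable P → ∀ N → (∀ k → P k → k ≤ N) →
  ∀ {m} → P m → ∃[ g ] (m ≤ g × P g × (∀ k → P k → k ≤ g))
maximum-exists P? N bound Pm with P? N
... | yes PN = N , bound _ Pm , PN , bound
maximum-exists {P = P} P? zero    bound Pm | no ¬PN = contradiction (subst P (n≤0⇒n≡0 (bound _ Pm)) Pm) ¬PN
maximum-exists {P = P} P? (suc N) bound Pm | no ¬PN = maximum-exists P? N bound′ Pm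
  where
  bound′ : ∀ k → P k → k ≤ N
  bound′ k Pk = ≤-pred (≤∧≢⇒< (bound k Pk) λ { refl → ¬PN Pk })

module _ (X : Graph) where

  IsGreedyColouring : ∀ k → (Fin (n X) → Fin k) → Set
  IsGreedyColouring k col =
    (∀ i → ∃[ v ] col v ≡ i) ×
    (∀ u v → Adj X u v → col u ≢ col v) ×
    (∀ v j → toℕ j < toℕ (col v) → ∃[ u ] (Adj X v u × col u ≡ j))

  isGreedyColouring-resp : ∀ {k} {c d : Fin (n X) → Fin k} → c ≗ d →
    IsGreedyColouring k c → IsGreedyColouring k d
  isGreedyColouring-resp c≗d (nonempty , stable , greedy) =
    (λ i → let (v , e) = nonempty i in v , trans (sym (c≗d v)) e) ,
    (λ u v a e → stable u v a (trans (c≗d u) (trans e (sym (c≗d v))))) ,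
    (λ v j lt → let (u , a , e) = greedy v j (subst (λ c → toℕ j < toℕ c) (sym (c≗d v)) lt)
                in u , a , trans (sym (c≗d u)) e)

  isGreedyColouring? : ∀ k col → Dec (IsGreedyColouring k col)
  isGreedyColouring? k col =
    all? (λ i → any? λ v → col v ≟ i) ×-dec
    all? (λ u → all? λ v → (adj X u v Bool.≟ true) →-dec ¬? (col u ≟ col v)) ×-dec
    all? (λ v → all? λ j → (toℕ j <? toℕ (col v)) →-dec
      any? λ u → (adj X v u Bool.≟ true) ×-dec (col u ≟ j))

  greedyColouring? : ∀ k → Dec (GreedyColouring X k)
  greedyColouring? k =
    map′ (λ (col , nonempty , stable , greedy) → record
           { col = col ; nonempty = nonempty ; stable = stable ; greedy = greedy })
         (λ C → let open GreedyColouring C in col , nonempty , stable , greedy)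
         (∃-function? (n X) k (IsGreedyColouring k) isGreedyColouring-resp (isGreedyColouring? k))

  colours≤vertices : ∀ {k} → GreedyColouring X k → k ≤ n X
  colours≤vertices C = injective⇒≤ {f = proj₁ ∘ nonempty}
    λ {i} {j} e → trans (sym (proj₂ (nonempty i))) (trans (cong col e) (proj₂ (nonempty j)))
    where open GreedyColouring C

  grundy-exists : ∀ {m} → GreedyColouring X m → ∃[ g ] (m ≤ g × IsGrundy X g)
  grundy-exists = maximum-exists greedyColouring? (n X) (λ _ → colours≤vertices)

module _ (G : Graph) where

  cone-adj : Fin (suc (n G)) → Fin (suc (n G)) → Bool
  cone-adj zero    zero    = false
  cone-adj zero    (suc _) = true
  cone-adj (suc _) zero    = true
  cone-adj (suc a) (suc b) = adj G a b

  cone-adj-sym : ∀ u v → cone-adj u v ≡ cone-adj v u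
  cone-adj-sym zero    zero    = refl
  cone-adj-sym zero    (suc _) = refl
  cone-adj-sym (suc _) zero    = refl
  cone-adj-sym (suc a) (suc b) = Graph.sym G a b

  cone-adj-irr : ∀ v → cone-adj v v ≡ false
  cone-adj-irr zero    = refl
  cone-adj-irr (suc a) = irr G a

cone : Graph → Graph
cone G = record { n = suc (n G) ; adj = cone-adj G ; sym = cone-adj-sym G ; irr = cone-adj-irr G }

cone-colouring : ∀ {G k} → GreedyColouring G k → GreedyColouring (cone G) (suc k)
cone-colouring {G} {k} C = record { col = col′ ; nonempty = nonempty′ ; stable = stable′ ; greedy = greedy′ }
  where
  open GreedyColouring C
  col′ : Fin (suc (n G)) → Fin (suc k)
  col′ zero    = zero
  col′ (suc a) = suc (col a)
  nonempty′ : ∀ i → ∃[ v ] col′ v ≡ i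
  nonempty′ zero    = zero , refl
  nonempty′ (suc i) = let (a , e) = nonempty i in suc a , cong suc e
  stable′ : ∀ u v → Adj (cone G) u v → col′ u ≢ col′ v
  stable′ zero    (suc b) _ ()
  stable′ (suc a) zero    _ ()
  stable′ (suc a) (suc b) e = stable a b e ∘ suc-injective
  greedy′ : ∀ v j → toℕ j < toℕ (col′ v) → ∃[ u ] (Adj (cone G) v u × col′ u ≡ j)
  greedy′ (suc a) zero    _  = zero , refl , refl
  greedy′ (suc a) (suc j) lt = let (u , e , c) = greedy a j (s<s⁻¹ lt) in suc u , e , cong suc c

punchIn-mono-< : ∀ {m} c (j k : Fin m) → toℕ j < toℕ k → toℕ (punchIn c j) < toℕ (punchIn c k)
punchIn-mono-< c j k j<k = ≰⇒> λ k′≤j′ → <⇒≱ j<k (punchIn-cancel-≤ c k j k′≤j′)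

-- The apex is adjacent to every other vertex, so its colour class is a
-- singleton; deleting that class and renumbering by punchOut leaves a greedy
-- colouring of G.
uncone-colouring : ∀ {G m} → GreedyColouring (cone G) (suc m) → GreedyColouring G m
uncone-colouring {G} {m} C = record { col = col′ ; nonempty = nonempty′ ; stable = stable′ ; greedy = greedy′ }
  where
  open GreedyColouring C
  apex≢ : ∀ a → col zero ≢ col (suc a)
  apex≢ a = stable zero (suc a) refl
  col′ : Fin (n G) → Fin m
  col′ a = punchOut (apex≢ a)
  off-apex : ∀ {v} i → col v ≡ punchIn (col zero) i → ∃[ a ] (v ≡ suc a × col′ a ≡ i)
  off-apex {zero}  i e = ⊥-elim (punchInᵢ≢i (col zero) i (sym e))
  off-apex {suc a} i e = a , refl , trans (punchOut-cong′ (col zero) e) (punchOut-punchIn (col zero))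
  nonempty′ : ∀ i → ∃[ a ] col′ a ≡ i
  nonempty′ i with nonempty (punchIn (col zero) i)
  ... | v , e with off-apex i e
  ... | a , refl , c = a , c
  stable′ : ∀ a b → Adj G a b → col′ a ≢ col′ b
  stable′ a b e = stable (suc a) (suc b) e ∘ punchOut-injective (apex≢ a) (apex≢ b)
  greedy′ : ∀ a j → toℕ j < toℕ (col′ a) → ∃[ b ] (Adj G a b × col′ b ≡ j)
  greedy′ a j lt with greedy (suc a) (punchIn (col zero) j)
                        (subst (λ c → toℕ (punchIn (col zero) j) < toℕ c) (punchIn-punchOut (apex≢ a))
                           (punchIn-mono-< (col zero) j (col′ a) lt))
  ... | u , e , c with off-apex j c
  ... | b , refl , c′ = b , e , c′

Γ-cone : ∀ {G k} → IsGrundy G k → IsGrundy (cone G) (suc k)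
Γ-cone (C , maximal) = cone-colouring C , λ where
  zero    _  → z≤n
  (suc m) C′ → s≤s (maximal m (uncone-colouring C′))

module _ (G H : Graph) where

  PairAdj : Fin (n G) × Fin (n H) → Fin (n G) × Fin (n H) → Set
  PairAdj p q = pairAdj G H p q ≡ true

  record GreedyPairColouring (k : ℕ) : Set where
    field
      col      : Fin (n G) × Fin (n H) → Fin k
      nonempty : ∀ i → ∃[ p ] col p ≡ i
      stable   : ∀ p q → PairAdj p q → col p ≢ col q
      greedy   : ∀ p j → toℕ j < toℕ (col p) → ∃[ q ] (PairAdj p q × col q ≡ j)

  private
    vertex : Fin (n G) × Fin (n H) → Fin (n G * n H)
    vertex = uncurry combine

    pair-vertex : ∀ p → remQuot (n H) (vertex p) ≡ p
    pair-vertex = uncurry remQuot-combine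

    vertex-pair : ∀ v → vertex (remQuot (n H) v) ≡ v
    vertex-pair = combine-remQuot {n G} (n H)

  toPairColouring : ∀ {k} → GreedyColouring (lex G H) k → GreedyPairColouring k
  toPairColouring C = record
    { col      = col ∘ vertex
    ; nonempty = λ i → let (v , e) = nonempty i in remQuot (n H) v , trans (cong col (vertex-pair v)) e
    ; stable   = λ p q a → stable (vertex p) (vertex q) (subst₂ PairAdj (sym (pair-vertex p)) (sym (pair-vertex q)) a)
    ; greedy   = λ p j lt → let (u , a , e) = greedy (vertex p) j lt in
        remQuot (n H) u , subst (λ p′ → PairAdj p′ (remQuot (n H) u)) (pair-vertex p) a ,
        trans (cong col (vertex-pair u)) e
    }
    where open GreedyColouring C

  fromPairColouring : ∀ {k} → GreedyPairColouring k → GreedyColouring (lex G H) k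
  fromPairColouring C = record
    { col      = col ∘ remQuot (n H)
    ; nonempty = λ i → let (p , e) = nonempty i in vertex p , trans (cong col (pair-vertex p)) e
    ; stable   = λ u v → stable (remQuot (n H) u) (remQuot (n H) v)
    ; greedy   = λ v j lt → let (q , a , e) = greedy (remQuot (n H) v) j lt in
        vertex q , subst (PairAdj (remQuot (n H) v)) (sym (pair-vertex q)) a ,
        trans (cong col (pair-vertex q)) e
    }
    where open GreedyPairColouring C

data SplitAtView (g l : ℕ) : Fin (g + l) → Set where
  left  : ∀ i → SplitAtView g l (i ↑ˡ l)
  right : ∀ i → SplitAtView g l (g ↑ʳ i)

splitAtView : ∀ g l j → SplitAtView g l j
splitAtView g l j with splitAt g j in eq
... | inj₁ i = subst (SplitAtView g l) (splitAt⁻¹-↑ˡ eq) (left i)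
... | inj₂ i = subst (SplitAtView g l) (splitAt⁻¹-↑ʳ eq) (right i)

↑ˡ<↑ʳ : ∀ {g l} (i : Fin g) (j : Fin l) → toℕ (i ↑ˡ l) < toℕ (g ↑ʳ j)
↑ˡ<↑ʳ {g} {l} i j rewrite toℕ-↑ˡ i l | toℕ-↑ʳ g j = <-≤-trans (toℕ<n i) (m≤m+n g (toℕ j))

↑ˡ≢↑ʳ : ∀ {g l} (i : Fin g) (j : Fin l) → i ↑ˡ l ≢ g ↑ʳ j
↑ˡ≢↑ʳ i j e = <-irrefl (cong toℕ e) (↑ˡ<↑ʳ i j)

↑ˡ-cancel-< : ∀ {g} l (i j : Fin g) → toℕ (i ↑ˡ l) < toℕ (j ↑ˡ l) → toℕ i < toℕ j
↑ˡ-cancel-< l i j rewrite toℕ-↑ˡ i l | toℕ-↑ˡ j l = λ lt → lt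

↑ʳ-cancel-< : ∀ g {l} (i j : Fin l) → toℕ (g ↑ʳ i) < toℕ (g ↑ʳ j) → toℕ i < toℕ j
↑ʳ-cancel-< g i j rewrite toℕ-↑ʳ g i | toℕ-↑ʳ g j = +-cancelˡ-< g (toℕ i) (toℕ j)

cone-pairAdj-suc : ∀ G H a x b y → pairAdj (cone G) H (suc a , x) (suc b , y) ≡ pairAdj G H (a , x) (b , y)
cone-pairAdj-suc G H a x b y = cong (λ t → adj G a b ∨ (t ∧ adj H x y)) (⌊⌋-map′ _ _ (a ≟ b))

cone-lex-colouring : ∀ {G H g l} → GreedyPairColouring G H g → GreedyColouring H l →
  GreedyPairColouring (cone G) H (g + l)
cone-lex-colouring {G} {H} {g} {l} C D = record
  { col = col′ ; nonempty = nonempty′ ; stable = stable′ ; greedy = greedy′ }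
  where
  module C = GreedyPairColouring C
  module D = GreedyColouring D
  col′ : Fin (suc (n G)) × Fin (n H) → Fin (g + l)
  col′ (zero  , x) = g ↑ʳ D.col x
  col′ (suc a , x) = C.col (a , x) ↑ˡ l
  nonempty′ : ∀ j → ∃[ p ] col′ p ≡ j
  nonempty′ j with splitAtView g l j
  ... | left i  = let ((a , x) , e) = C.nonempty i in (suc a , x) , cong (_↑ˡ l) e
  ... | right i = let (x , e) = D.nonempty i in (zero , x) , cong (g ↑ʳ_) e
  stable′ : ∀ p q → PairAdj (cone G) H p q → col′ p ≢ col′ q
  stable′ (zero  , x) (zero  , y) xy = D.stable x y xy ∘ ↑ʳ-injective g _ _
  stable′ (zero  , x) (suc b , y) _ = ↑ˡ≢↑ʳ _ _ ∘ sym
  stable′ (suc a , x) (zero  , y) _ = ↑ˡ≢↑ʳ _ _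
  stable′ (suc a , x) (suc b , y) e =
    C.stable (a , x) (b , y) (trans (sym (cone-pairAdj-suc G H a x b y)) e) ∘ ↑ˡ-injective l _ _
  greedy′ : ∀ p j → toℕ j < toℕ (col′ p) → ∃[ q ] (PairAdj (cone G) H p q × col′ q ≡ j)
  greedy′ (zero , x) j lt with splitAtView g l j
  ... | left i  = let ((a , y) , e) = C.nonempty i in (suc a , y) , refl , cong (_↑ˡ l) e
  ... | right i = let (y , a , e) = D.greedy x i (↑ʳ-cancel-< g i (D.col x) lt) in
                  (zero , y) , a , cong (g ↑ʳ_) e
  greedy′ (suc a , x) j lt with splitAtView g l j
  ... | left i  = let ((b , y) , e , c) = C.greedy (a , x) i (↑ˡ-cancel-< l i (C.col (a , x)) lt) in
                  (suc b , y) , trans (cone-pairAdj-suc G H a x b y) e , cong (_↑ˡ l) c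
  ... | right i = ⊥-elim (<-asym lt (↑ˡ<↑ʳ _ i))

Γ-lex-cone : ∀ {G H g l} → IsGrundy (lex G H) g → IsGrundy H l →
  ∃[ g′ ] (g + l ≤ g′ × IsGrundy (lex (cone G) H) g′)
Γ-lex-cone {G} {H} (C , _) (D , _) =
  grundy-exists (lex (cone G) H) (fromPairColouring (cone G) H (cone-lex-colouring (toPairColouring G H C) D))

ψ-exceeds : ℕ → ℕ → ℕ → Set
ψ-exceeds k l α = ∃[ G ] ∃[ H ] ∃[ g ] (IsGrundy G k × IsGrundy H l × IsGrundy (lex G H) g × k * l + α ≤ g)

ψ-exceeds-suc : ∀ {k l α} → ψ-exceeds k l α → ψ-exceeds (suc k) l α
ψ-exceeds-suc {k} {l} {α} (G , H , g , Gk , Hl , GHg , kl+α≤g) =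
  let (g′ , g+l≤g′ , GHg′) = Γ-lex-cone GHg Hl
  in cone G , H , g′ , Γ-cone Gk , Hl , GHg′ , ≤-trans bound g+l≤g′
  where
  open ≤-Reasoning
  bound : suc k * l + α ≤ g + l
  bound = begin
    suc k * l + α   ≡⟨ +-assoc l (k * l) α ⟩
    l + (k * l + α) ≤⟨ +-monoʳ-≤ l kl+α≤g ⟩
    l + g           ≡⟨ +-comm l g ⟩
    g + l           ∎

ψ-exceeds-mono : ∀ {k k′ l α} → k ≤′ k′ → ψ-exceeds k l α → ψ-exceeds k′ l α
ψ-exceeds-mono ≤′-refl        = id
ψ-exceeds-mono (≤′-step k≤k′) = ψ-exceeds-suc ∘ ψ-exceeds-mono k≤k′

lemma18 : ∀ (k l α : ℕ) → 1 ≤ k → 1 ≤ l → 1 ≤ α →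
    (∃[ G ] ∃[ H ] ∃[ g ] (IsGrundy G k × IsGrundy H l × IsGrundy (lex G H) g × k * l + α ≤ g)) →
    ∀ (k′ : ℕ) → k < k′ →
    ∃[ G ] ∃[ H ] ∃[ g ] (IsGrundy G k′ × IsGrundy H l × IsGrundy (lex G H) g × k′ * l + α ≤ g)
lemma18 k l α _ _ _ ψ≥ k′ k<k′ = ψ-exceeds-mono (≤⇒≤′ k<k′) (ψ-exceeds-suc ψ≥)
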